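{- Let $s_{\mathcal{D}}\in\mathcal{S}_T$, let $t\in J(s_{\mathcal{D}})$, and let $\mathcal{D}(t):=\{s'\in J(s_{\mathcal{D}}): s'\text{ is a split of }t\}$ (so that $t_{\mathcal{D}(t)}\in\mathcal{S}_T$). Then $J(t_{\mathcal{D}(t)})\subseteq J(s_{\mathcal{D}})$. Moreover, $J(t_{\mathcal{D}(t)})$ is the set of subsegments of $t$ that belong to $J(s_{\mathcal{D}})$.
   Context: Let $T$ be a finite tree embedded in a disk so that exactly its leaves lie on the boundary, with every non-leaf vertex of degree at least $3$; the embedding gives a cyclic order of edges at each vertex. A segment is an acyclic path $(v_1,\dots,v_n)$, $n\ge2$, of pairwise distinct consecutive-adjacent vertices such that for each $1\le j\le n-2$ the edge $\{v_{j+1},v_{j+2}\}$ is immediately clockwise or counterclockwise from $\{v_j,v_{j+1}\}$ at $v_{j+1}$; $\mathrm{Seg}(T)$ is the set of segments; a subsegment of a segment is a segment whose vertices form a contiguous subsequence of its vertices (the segment itself included). For segments $s_1=(v_1,\dots,v_k)$, $s_2=(v_k,\dots,v_n)$ sharing only $v_k$, $s_1\circ s_2=(v_1,\dots,v_n)$; they are composable if this is a segment. A split of a segment $t$ is a proper subsegment of $t$ sharing an endpoint with $t$; a break of $[a,c]$ is a pair $\{[a,b],[b,c]\}$ with $b$ a vertex of $[a,c]$ strictly between $a$ and $c$. $\mathcal{S}_T$ is the set of labels $s_{\mathcal{D}}=(s,\mathcal{D})$ with $s\in\mathrm{Seg}(T)$ having $m$ breaks and $\mathcal{D}$ a set of $m$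 splits of $s$ no two in the same break. For $s_{\mathcal{D}}\in\mathcal{S}_T$, $J(s_{\mathcal{D}}):=\{s\}\sqcup\mathcal{D}\sqcup\bigcup_{t\in\mathcal{D}}S(t)$, where $S(t)$ is the set of splits $s'$ of $t$ such that $s'$ is not a split of $s$ and $s'$ is not composable with any segment of $\mathcal{D}$. -}

module Defs where

open import Data.Nat using (ℕ; _≤_; _∸_)
open import Data.Fin using (Fin)
open import Data.List using (List; []; _∷_; _++_; [_]; _∷ʳ_; length)
open import Data.List.Membership.Propositional using (_∈_; _∉_)
open import Data.List.Relation.Unary.Unique.Propositional using (Unique)
open import Data.List.Relation.Unary.Linked using (Linked)
open import Data.Product using (Σ; ∃; ∃-syntax; _×_; _,_)
open import Data.Sum using (_⊎_)
open import Data.Unit using (⊤)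
open import Relation.Nullary using (¬_)
open import Relation.Binary.PropositionalEquality using (_≡_; _≢_)
open import Function.Bundles using (_⇔_)

-- Cyclic successor in a list read as a cyclic order:
-- c immediately follows a in the cyclic order represented by l.
CycNext : {A : Set} → List A → A → A → Set
CycNext {A} l a c =
  (Σ (List A) λ xs → Σ (List A) λ ys → l ≡ xs ++ a ∷ c ∷ ys)
  ⊎ (Σ (List A) λ mid → l ≡ c ∷ (mid ∷ʳ a))

-- A finite plane tree: vertices Fin n; nbrs v lists the neighbours of v
-- in clockwise cyclic order (the rotation system given by the embedding).
record PlaneTree : Set where
  field
    n        : ℕ
    nbrs     : Fin n → List (Fin n)
    nbrs-unique : ∀ v → Unique (nbrs v)
    loopless : ∀ v → v ∉ nbrs v
    symm     : ∀ u v → u ∈ nbrs v → v ∈ nbrs u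
  Adj : Fin n → Fin n → Set
  Adj u v = v ∈ nbrs u
  field
    connected : ∀ u v → u ≡ v ⊎ (Σ (List (Fin n)) λ l → Linked Adj (u ∷ l ∷ʳ v))
    acyclic  : ∀ x (l : List (Fin n)) → 2 ≤ length l → Unique (x ∷ l) →
               ¬ Linked Adj (x ∷ l ∷ʳ x)
    degree   : ∀ v → length (nbrs v) ≡ 1 ⊎ 3 ≤ length (nbrs v)

HasCard : {A : Set} → (A → Set) → ℕ → Set
HasCard {A} P m = Σ (List A) λ L → Unique L × (∀ x → P x ⇔ x ∈ L) × length L ≡ m

module _ (T : PlaneTree) where
  open PlaneTree T

  V : Set
  V = Fin n

  -- edge {b,c} is immediately clockwise or counterclockwise from {a,b} at b
  Turn : V → V → V → Set
  Turn a b c = CycNext (nbrs b) a c ⊎ CycNext (nbrs b) c a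

  Turns : List V → Set
  Turns (a ∷ b ∷ c ∷ r) = Turn a b c × Turns (b ∷ c ∷ r)
  Turns _ = ⊤

  IsSegment : List V → Set
  IsSegment l = 2 ≤ length l × Unique l × Linked Adj l × Turns l

  IsSubseg : List V → List V → Set
  IsSubseg s' s = IsSegment s' × Σ (List V) λ xs → Σ (List V) λ ys → s ≡ xs ++ s' ++ ys

  IsEnd : V → List V → Set
  IsEnd x l = (Σ (List V) λ r → l ≡ x ∷ r) ⊎ (Σ (List V) λ r → l ≡ r ∷ʳ x)

  IsSplit : List V → List V → Set
  IsSplit s' t = IsSubseg s' t × s' ≢ t × (Σ V λ x → IsEnd x s' × IsEnd x t)

  -- (p , q) is the break {[a,b],[b,c]} of s = [a,c] at an interior vertex b
  IsBreak : List V → List V × List V → Set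
  IsBreak s (p , q) = Σ (List V) λ xs → Σ V λ b → Σ (List V) λ ys →
    s ≡ xs ++ b ∷ ys × xs ≢ [] × ys ≢ [] × p ≡ xs ∷ʳ b × q ≡ b ∷ ys

  SameBreak : List V → List V → List V → Set
  SameBreak s d₁ d₂ = d₁ ≢ d₂ × (Σ (List V) λ p → Σ (List V) λ q →
    IsBreak s (p , q) × (d₁ ≡ p ⊎ d₁ ≡ q) × (d₂ ≡ p ⊎ d₂ ≡ q))

  Composable : List V → List V → Set
  Composable s₁ s₂ = Σ (List V) λ xs → Σ V λ k → Σ (List V) λ ys →
    s₁ ≡ xs ∷ʳ k × s₂ ≡ k ∷ ys × IsSegment s₁ × IsSegment s₂ ×
    (∀ x → x ∈ s₁ → x ∈ s₂ → x ≡ k) × IsSegment (xs ++ k ∷ ys)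

  ComposableWith : List V → List V → Set
  ComposableWith a b = Composable a b ⊎ Composable b a

  IsLabel : List V → (List V → Set) → Set
  IsLabel s 𝒟 = IsSegment s
    × (∀ d → 𝒟 d → IsSplit d s)
    × (∀ d₁ d₂ → 𝒟 d₁ → 𝒟 d₂ → ¬ SameBreak s d₁ d₂)
    × (Σ ℕ λ m → HasCard (IsBreak s) m × HasCard 𝒟 m)

  InS : List V → (List V → Set) → List V → List V → Set
  InS s 𝒟 t s' = IsSplit s' t × ¬ IsSplit s' s × (∀ u → 𝒟 u → ¬ ComposableWith s' u)

  InJ : List V → (List V → Set) → List V → Set
  InJ s 𝒟 x = x ≡ s ⊎ 𝒟 x ⊎ (Σ (List V) λ t → 𝒟 t × InS s 𝒟 t x)

  Dof : List V → (List V → Set) → List V → List V → Set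
  Dof s 𝒟 t s' = InJ s 𝒟 s' × IsSplit s' t

module Submission where

-- Every segment in sight is a block (contiguous piece) of the segment s, and
-- we work with offsets in s.  The splits of s are its proper prefixes and
-- suffixes; the break of s at an interior position j is the prefix ending at j
-- together with the suffix starting at j.  A label D contains exactly one part
-- of each break: at most one by definition, at least one by counting (D has as
-- many members as there are breaks, and distinct members lie in distinct
-- breaks).  This yields the interval description of J(s_D) (module Intervals):
-- a block of s lies in J(s_D) iff s is cut at both of its ends, where a is a
-- left cut if a = 0 or the suffix of s starting at a is in D, and e is a right
-- cut if e = |s| or the prefix of s ending at e is in D.  For t ∈ J(s_D) at
-- offset a₀ the cuts of t for D(t) are the cuts of s shifted by a₀ (module
-- Heredity).  Hence D(t) contains exactly one part of each break of t, so
-- t_D(t) is a label, and the blocks of t in J(t_D(t)) are those in J(s_D).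

open import Defs
open import Data.Nat using (ℕ; zero; suc; pred; _+_; _∸_; _≤_; _<_; z≤n; s≤s; s≤s⁻¹)
open import Data.Nat.Properties
open import Data.Fin using () renaming (_≟_ to _≟ᶠ_)
open import Data.List using (List; []; _∷_; _++_; [_]; _∷ʳ_; length; map; take; drop; applyUpTo; initLast; _∷ʳ′_)
open import Data.List.Properties using (∷-injective; ++-assoc; ++-identityʳ; length-++; length-map; length-take; length-drop; take++drop≡id; length-applyUpTo; ≡-dec)
open import Data.List.Membership.Propositional using (_∈_)
open import Data.List.Membership.Propositional.Properties using (∈-++⁺ˡ; ∈-++⁺ʳ; ∈-++⁻; ∈-∃++; ∈-map⁺; ∈-map⁻; ∈-applyUpTo⁺)
import Data.List.Membership.DecPropositional as DecMembership
open import Data.List.Relation.Unary.Any using (here; there)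
open import Data.List.Relation.Unary.All as All using (All; []; _∷_)
import Data.List.Relation.Unary.All.Properties as All
open import Data.List.Relation.Unary.AllPairs using ([]; _∷_)
open import Data.List.Relation.Unary.Unique.Propositional using (Unique)
open import Data.List.Relation.Unary.Unique.Propositional.Properties using (Unique[x∷xs]⇒x∉xs)
open import Data.List.Relation.Unary.Linked using (Linked; []; [-]; _∷_)
open import Data.Product using (Σ; _×_; _,_; proj₁; proj₂)
import Data.Product as Product
open import Data.Product.Function.NonDependent.Propositional using (_×-⇔_)
open import Data.Sum using (_⊎_; inj₁; inj₂) renaming ([_,_] to ⊎-elim)
open import Data.Empty using (⊥; ⊥-elim)
open import Data.Unit using (tt)
open import Function using (id; _∘_)
open import Function.Bundles using (_⇔_; mk⇔; Equivalence)
open import Function.Construct.Composition using (_⇔-∘_)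
open import Function.Construct.Symmetry using (⇔-sym)
open import Relation.Nullary using (¬_; yes; no)
open import Relation.Nullary.Decidable using (decidable-stable)
open import Relation.Binary.Definitions using (DecidableEquality)
open import Relation.Binary.PropositionalEquality using (_≡_; _≢_; refl; sym; trans; cong; cong₂; subst; subst₂; module ≡-Reasoning)

-- Blocks of lists and lists without repetition.
module _ {A : Set} where

  -- Subsegments, splits and breaks are all blocks of a segment, and offsets are
  -- the coordinates in which the whole argument is carried out.
  At : List A → ℕ → List A → Set
  At s a x = Σ (List A) λ xs → Σ (List A) λ ys → s ≡ xs ++ x ++ ys × length xs ≡ a

  length-∷ʳ : ∀ (xs : List A) k → length (xs ∷ʳ k) ≡ suc (length xs)
  length-∷ʳ xs k = trans (length-++ xs) (+-comm (length xs) 1)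

  ++-cancel-aligned : ∀ (xs xs' : List A) {r r'} → length xs ≡ length xs' →
                      xs ++ r ≡ xs' ++ r' → xs ≡ xs' × r ≡ r'
  ++-cancel-aligned []       []         _ e = refl , e
  ++-cancel-aligned (x ∷ xs) (x' ∷ xs') l e with refl , e' ← ∷-injective e =
    Product.map (cong (x ∷_)) id (++-cancel-aligned xs xs' (suc-injective l) e')

  at-determined : ∀ {s a x x'} → At s a x → At s a x' → length x ≡ length x' → x ≡ x'
  at-determined (xs , ys , e , l) (xs' , ys' , e' , l') lx =
    proj₁ (++-cancel-aligned _ _ lx
      (proj₂ (++-cancel-aligned xs xs' (trans l (sym l')) (trans (sym e) e'))))

  at-bound : ∀ {s a x} → At s a x → a + length x ≤ length s
  at-bound {x = x} (xs , ys , refl , refl) = begin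
    length xs + length x                 ≤⟨ +-monoʳ-≤ (length xs) (m≤m+n (length x) (length ys)) ⟩
    length xs + (length x + length ys)   ≡⟨ cong (length xs +_) (sym (length-++ x)) ⟩
    length xs + length (x ++ ys)         ≡⟨ sym (length-++ xs) ⟩
    length (xs ++ x ++ ys)               ∎
    where open ≤-Reasoning

  at-whole : ∀ s → At s 0 s
  at-whole s = [] , [] , sym (++-identityʳ s) , refl

  at-trans : ∀ {s a y b x} → At s a y → At y b x → At s (a + b) x
  at-trans {x = x} (xs , ys , refl , refl) (us , vs , refl , refl) =
    xs ++ us , vs ++ ys ,
    trans (cong (xs ++_) (trans (++-assoc us (x ++ vs) ys) (cong (us ++_) (++-assoc x vs ys))))
          (sym (++-assoc xs us (x ++ vs ++ ys))) ,
    length-++ xs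

  at-prefix : ∀ {s a} x z → At s a (x ++ z) → At s a x
  at-prefix x z (xs , ys , e , l) = xs , z ++ ys , trans e (cong (xs ++_) (++-assoc x z ys)) , l

  at-suffix : ∀ {s a} x z → At s a (x ++ z) → At s (a + length x) z
  at-suffix x z (xs , ys , e , l) = xs ++ x , ys ,
    trans e (trans (cong (xs ++_) (++-assoc x z ys)) (sym (++-assoc xs x (z ++ ys)))) ,
    trans (length-++ xs) (cong (_+ length x) l)

  at-head : ∀ {s a y r} → At s a (y ∷ r) → At s a [ y ]
  at-head {r = r} = at-prefix [ _ ] r

  at-last : ∀ {s a} r k → At s a (r ∷ʳ k) → At s (a + length r) [ k ]
  at-last r k = at-suffix r [ k ]

  at-restrict : ∀ {s a x p} → At s 0 p → At s a x → length p ≡ a + length x → At p a x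
  at-restrict {x = x} {p} ([] , ys , e , _) (xs , ys' , e' , refl) lp =
    xs , [] , trans (proj₁ (++-cancel-aligned p (xs ++ x) (trans lp (sym (length-++ xs)))
                      (trans (sym e) (trans e' (sym (++-assoc xs x ys'))))))
                    (cong (xs ++_) (sym (++-identityʳ x))) , refl

  at-take : ∀ (s : List A) l → l ≤ length s → At s 0 (take l s) × length (take l s) ≡ l
  at-take s l le =
    ([] , drop l s , sym (take++drop≡id l s) , refl) , trans (length-take l s) (m≤n⇒m⊓n≡m le)

  at-drop : ∀ (s : List A) l → l ≤ length s → At s l (drop l s) × l + length (drop l s) ≡ length s
  at-drop s l le =
    (take l s , [] , trans (sym (take++drop≡id l s)) (cong (take l s ++_) (sym (++-identityʳ _))) ,
      trans (length-take l s) (m≤n⇒m⊓n≡m le)) ,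
    trans (cong (l +_) (length-drop l s)) (m+[n∸m]≡n le)

  at-glue : ∀ {s a} u k k' v → At s a (u ∷ʳ k) → At s (a + length u) (k' ∷ v) →
            k ≡ k' × At s a (u ++ k ∷ v)
  at-glue {s} u k k' v (xs , ys , e , refl) (xs' , ys' , e' , l') = k≡k' , xs , ys' , glued , refl
    where
    open ≡-Reasoning
    cut-after-u : s ≡ (xs ++ u) ++ k ∷ ys
    cut-after-u = trans e (trans (cong (xs ++_) (++-assoc u [ k ] ys)) (sym (++-assoc xs u (k ∷ ys))))
    cut : xs ++ u ≡ xs' × k ∷ ys ≡ k' ∷ v ++ ys'
    cut = ++-cancel-aligned (xs ++ u) xs' (trans (length-++ xs) (sym l')) (trans (sym cut-after-u) e')
    k≡k' : k ≡ k'
    k≡k' = proj₁ (∷-injective (proj₂ cut))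
    glued : s ≡ xs ++ (u ++ k ∷ v) ++ ys'
    glued = begin
      s                          ≡⟨ e' ⟩
      xs' ++ k' ∷ v ++ ys'       ≡⟨ cong₂ (λ w c → w ++ c ∷ v ++ ys') (sym (proj₁ cut)) (sym k≡k') ⟩
      (xs ++ u) ++ k ∷ v ++ ys'  ≡⟨ ++-assoc xs u _ ⟩
      xs ++ u ++ k ∷ v ++ ys'    ≡⟨ cong (xs ++_) (sym (++-assoc u (k ∷ v) ys')) ⟩
      xs ++ (u ++ k ∷ v) ++ ys'  ∎

  at-end : ∀ {s a x} → At s a x → a + length x ≡ length s → Σ (List A) λ xs → s ≡ xs ++ x
  at-end {x = x} (xs , []     , e    , _)    _  = xs , trans e (cong (xs ++_) (++-identityʳ x))
  at-end {x = x} (xs , y ∷ ys , refl , refl) eq =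
    ⊥-elim (m+1+n≢m (length xs + length x) (sym (trans eq len)))
    where
    len : length (xs ++ x ++ y ∷ ys) ≡ length xs + length x + suc (length ys)
    len = trans (length-++ xs) (trans (cong (length xs +_) (length-++ x))
                                      (sym (+-assoc (length xs) (length x) _)))

  split-at : ∀ (s : List A) i → i < length s →
             Σ (List A) λ w → Σ A λ k → Σ (List A) λ y → s ≡ w ++ k ∷ y × length w ≡ i
  split-at (a ∷ s) zero    _        = [] , a , s , refl , refl
  split-at (a ∷ s) (suc i) (s≤s lt) with w , k , y , e , l ← split-at s i lt =
    a ∷ w , k , y , cong (a ∷_) e , cong suc l

  unique-++ʳ : ∀ (u : List A) {w} → Unique (u ++ w) → Unique w
  unique-++ʳ []      un       = un
  unique-++ʳ (a ∷ u) (_ ∷ un) = unique-++ʳ u un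

  unique-++ˡ : ∀ (u : List A) {w} → Unique (u ++ w) → Unique u
  unique-++ˡ []      un       = []
  unique-++ˡ (a ∷ u) (h ∷ un) = All.++⁻ˡ u h ∷ unique-++ˡ u un

  unique-disjoint : ∀ (u : List A) {w z} → Unique (u ++ w) → z ∈ u → z ∈ w → ⊥
  unique-disjoint (a ∷ u) un       (here refl) zw = Unique[x∷xs]⇒x∉xs un (∈-++⁺ʳ u zw)
  unique-disjoint (a ∷ u) (_ ∷ un) (there zu)  zw = unique-disjoint u un zu zw

  unique-position : ∀ (xs xs' : List A) {y ys ys'} → Unique (xs ++ y ∷ ys) →
                    xs ++ y ∷ ys ≡ xs' ++ y ∷ ys' → length xs ≡ length xs'
  unique-position [] [] u e = refl
  unique-position [] (z ∷ xs') {y} u e with refl , e' ← ∷-injective e =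
    ⊥-elim (Unique[x∷xs]⇒x∉xs u (subst (y ∈_) (sym e') (∈-++⁺ʳ xs' (here refl))))
  unique-position (z ∷ xs) [] {y} u e with refl , _ ← ∷-injective e =
    ⊥-elim (Unique[x∷xs]⇒x∉xs u (∈-++⁺ʳ xs (here refl)))
  unique-position (z ∷ xs) (z' ∷ xs') (_ ∷ u) e =
    cong suc (unique-position xs xs' u (proj₂ (∷-injective e)))

  at-offset₁ : ∀ {s a b y} → Unique s → At s a [ y ] → At s b [ y ] → a ≡ b
  at-offset₁ u (xs , ys , refl , refl) (xs' , ys' , e' , refl) = unique-position xs xs' u e'

  at-offset : ∀ {s a b x} → Unique s → At s a x → At s b x → 1 ≤ length x → a ≡ b
  at-offset {x = _ ∷ _} u p q _ = at-offset₁ u (at-head p) (at-head q)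

  at-unique : ∀ {s a x} → Unique s → At s a x → Unique x
  at-unique {x = x} un (xs , ys , refl , _) = unique-++ˡ x (unique-++ʳ xs un)

  glue-shares-only : ∀ (u : List A) {k v z} → Unique (u ++ k ∷ v) →
                     z ∈ u ∷ʳ k → z ∈ k ∷ v → z ≡ k
  glue-shares-only u un zu (here refl) = refl
  glue-shares-only u un zu (there zv) with ∈-++⁻ u zu
  ... | inj₂ (here refl) = refl
  ... | inj₁ zu'         = ⊥-elim (unique-disjoint u un zu' (there zv))

  unique-⊆⇒length≤ : ∀ {xs ys : List A} → Unique xs → (∀ {z} → z ∈ xs → z ∈ ys) →
                     length xs ≤ length ys
  unique-⊆⇒length≤ {[]}     _        _   = z≤n
  unique-⊆⇒length≤ {x ∷ xs} {ys} un@(_ ∷ un') sub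
    with ys₁ , ys₂ , refl ← ∈-∃++ (sub (here refl)) = begin
      suc (length xs)                   ≤⟨ s≤s (unique-⊆⇒length≤ un' sub') ⟩
      suc (length (ys₁ ++ ys₂))          ≡⟨ cong suc (length-++ ys₁) ⟩
      suc (length ys₁ + length ys₂)      ≡⟨ sym (+-suc (length ys₁) (length ys₂)) ⟩
      length ys₁ + suc (length ys₂)      ≡⟨ sym (length-++ ys₁) ⟩
      length (ys₁ ++ [ x ] ++ ys₂)       ∎
    where
    open ≤-Reasoning
    sub' : ∀ {z} → z ∈ xs → z ∈ ys₁ ++ ys₂
    sub' {z} zx with ∈-++⁻ ys₁ (sub (there zx))
    ... | inj₁ p           = ∈-++⁺ˡ p
    ... | inj₂ (here refl) = ⊥-elim (Unique[x∷xs]⇒x∉xs un zx)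
    ... | inj₂ (there p)   = ∈-++⁺ʳ ys₁ p

  unique-map : ∀ {B : Set} (f : A → B) {xs : List A} → Unique xs →
               (∀ {x y} → x ∈ xs → y ∈ xs → f x ≡ f y → x ≡ y) → Unique (map f xs)
  unique-map f {[]}     _        _   = []
  unique-map f {x ∷ xs} (h ∷ u) inj =
    All.map⁺ (fresh xs h (λ y∈ → inj (here refl) (there y∈))) ∷
    unique-map f u (λ p q → inj (there p) (there q))
    where
    fresh : ∀ ys → All (x ≢_) ys → (∀ {y} → y ∈ ys → f x ≡ f y → x ≡ y) →
            All (λ y → f x ≢ f y) ys
    fresh []       _        _ = []
    fresh (y ∷ ys) (n ∷ ns) g = (λ e → n (g (here refl) e)) ∷ fresh ys ns (λ p → g (there p))

  hasCard-unique : ∀ {P : A → Set} {m m'} → HasCard P m → HasCard P m' → m ≡ m'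
  hasCard-unique (L , u , iff , refl) (L' , u' , iff' , refl) =
    ≤-antisym (unique-⊆⇒length≤ u  (λ {z} zm → Equivalence.to (iff' z) (Equivalence.from (iff z) zm)))
              (unique-⊆⇒length≤ u' (λ {z} zm → Equivalence.to (iff z) (Equivalence.from (iff' z) zm)))

  linked-++ʳ : ∀ {R : A → A → Set} (u : List A) {w} → Linked R (u ++ w) → Linked R w
  linked-++ʳ []               l       = l
  linked-++ʳ (a ∷ [])  {[]}   l       = []
  linked-++ʳ (a ∷ [])  {_ ∷ _} (_ ∷ l) = l
  linked-++ʳ (a ∷ b ∷ u)      (_ ∷ l) = linked-++ʳ (b ∷ u) l

  linked-++ˡ : ∀ {R : A → A → Set} (u : List A) {w} → Linked R (u ++ w) → Linked R u
  linked-++ˡ []          l       = []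
  linked-++ˡ (a ∷ [])    l       = [-]
  linked-++ˡ (a ∷ b ∷ u) (r ∷ l) = r ∷ linked-++ˡ (b ∷ u) l

  at-linked : ∀ {R : A → A → Set} {s a x} → Linked R s → At s a x → Linked R x
  at-linked {x = x} l (xs , ys , refl , _) = linked-++ˡ x (linked-++ʳ xs l)

no-room-after : ∀ a b → a + b ≤ suc a → 2 ≤ b → ⊥
no-room-after a b le l2 = 1+n≰n (≤-trans l2 (+-cancelˡ-≤ a b 1 (subst (a + b ≤_) (+-comm 1 a) le)))

-- Segments, splits and breaks in a plane tree T, and counting breaks.
module _ (T : PlaneTree) where

  private
    Path : Set
    Path = List (V T)

  turns-tail : ∀ a l → Turns T (a ∷ l) → Turns T l
  turns-tail a []          _       = tt
  turns-tail a (b ∷ [])    _       = tt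
  turns-tail a (b ∷ c ∷ r) (_ , t) = t

  turns-++ʳ : ∀ (u : Path) {w} → Turns T (u ++ w) → Turns T w
  turns-++ʳ []      t = t
  turns-++ʳ (a ∷ u) t = turns-++ʳ u (turns-tail a (u ++ _) t)

  turns-++ˡ : ∀ (u : Path) {w} → Turns T (u ++ w) → Turns T u
  turns-++ˡ []              t       = tt
  turns-++ˡ (a ∷ [])        t       = tt
  turns-++ˡ (a ∷ b ∷ [])    t       = tt
  turns-++ˡ (a ∷ b ∷ c ∷ u) (x , t) = x , turns-++ˡ (b ∷ c ∷ u) t

  segment-block : ∀ {s a x} → IsSegment T s → At s a x → 2 ≤ length x → IsSegment T x
  segment-block {x = x} (_ , u , l , t) p@(xs , ys , refl , _) l2 =
    l2 , at-unique u p , at-linked l p , turns-++ˡ x (turns-++ʳ xs t)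

  IsPrefix : Path → Path → Set
  IsPrefix s x = At s 0 x × 2 ≤ length x × length x < length s

  IsSuffix : Path → Path → Set
  IsSuffix s x = Σ ℕ λ a → At s a x × a + length x ≡ length s × 2 ≤ length x × 1 ≤ a

  prefix⇒split : ∀ {s x} → IsSegment T s → IsPrefix s x → IsSplit T x s
  prefix⇒split {s} {y ∷ r} sg (p@([] , ys , e , refl) , l2 , lt) =
    (segment-block sg p l2 , [] , ys , e) , (λ eq → <-irrefl (cong length eq) lt) ,
    y , inj₁ (r , refl) , inj₁ (r ++ ys , e)

  suffix⇒split : ∀ {s x} → IsSegment T s → IsSuffix s x → IsSplit T x s
  suffix⇒split {s} {x} sg (a , p , eq , l2 , a1) with initLast x | at-end p eq
  suffix⇒split sg (a , p , eq , () , a1) | []      | _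
  ... | r ∷ʳ′ k | xs , e =
    (segment-block sg p l2 , proj₁ p , proj₁ (proj₂ p) , proj₁ (proj₂ (proj₂ p))) ,
    proper , k , inj₂ (r , refl) , inj₂ (xs ++ r , trans e (sym (++-assoc xs r [ k ])))
    where
    proper : r ∷ʳ k ≢ s
    proper x≡s = n>0⇒n≢0 a1 (+-cancelʳ-≡ (length s) a 0 (subst (λ z → a + length z ≡ length s) x≡s eq))

  split⇒prefix⊎suffix : ∀ {s x} → Unique s → IsSplit T x s → IsPrefix s x ⊎ IsSuffix s x
  -- x and s both start at y: x sits at offset 0.
  split⇒prefix⊎suffix {s} {.(y ∷ r)} un
    ((sgx , xs , ys , e) , x≢s , y , inj₁ (r , refl) , inj₁ (r' , es)) =
    inj₁ (A0 , proj₁ sgx , ≤∧≢⇒< (at-bound A0) (λ eqn → x≢s (at-determined A0 (at-whole s) eqn)))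
    where
    A : At s (length xs) (y ∷ r)
    A = xs , ys , e , refl
    A0 : At s 0 (y ∷ r)
    A0 = subst (λ a → At s a (y ∷ r)) (at-offset₁ un (at-head A) ([] , r' , es , refl)) A
  -- x starts where s ends: no room for a second vertex.
  split⇒prefix⊎suffix {s} {.(y ∷ r)} un
    ((sgx , xs , ys , e) , x≢s , y , inj₁ (r , refl) , inj₂ (r' , es)) =
    ⊥-elim (no-room-after (length r') (length (y ∷ r))
      (subst₂ _≤_ (cong (_+ length (y ∷ r)) y-offset) (trans (cong length es) (length-∷ʳ r' y)) (at-bound A))
      (proj₁ sgx))
    where
    A : At s (length xs) (y ∷ r)
    A = xs , ys , e , refl
    y-offset : length xs ≡ length r'
    y-offset = at-offset₁ un (at-head A) (r' , [] , es , refl)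
  -- x ends where s starts: x would be the single vertex y.
  split⇒prefix⊎suffix {s} {.(r ∷ʳ y)} un
    ((sgx , xs , ys , e) , x≢s , y , inj₂ (r , refl) , inj₁ (r' , es)) =
    ⊥-elim (n>0⇒n≢0 (s≤s⁻¹ (subst (2 ≤_) (length-∷ʳ r y) (proj₁ sgx))) (m+n≡0⇒n≡0 (length xs) y-offset))
    where
    y-offset : length xs + length r ≡ 0
    y-offset = at-offset₁ un (at-last r y (xs , ys , e , refl)) ([] , r' , es , refl)
  -- x and s both end at y: x is a suffix, proper since x ≢ s.
  split⇒prefix⊎suffix {s} {.(r ∷ʳ y)} un
    ((sgx , xs , ys , e) , x≢s , y , inj₂ (r , refl) , inj₂ (r' , es)) =
    inj₂ (length xs , A , ends , proj₁ sgx , n≢0⇒n>0 starts-late)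
    where
    A : At s (length xs) (r ∷ʳ y)
    A = xs , ys , e , refl
    y-offset : length xs + length r ≡ length r'
    y-offset = at-offset₁ un (at-last r y A) (r' , [] , es , refl)
    ends : length xs + length (r ∷ʳ y) ≡ length s
    ends = begin
      length xs + length (r ∷ʳ y)   ≡⟨ cong (length xs +_) (length-∷ʳ r y) ⟩
      length xs + suc (length r)    ≡⟨ +-suc (length xs) (length r) ⟩
      suc (length xs + length r)    ≡⟨ cong suc y-offset ⟩
      suc (length r')               ≡⟨ sym (trans (cong length es) (length-∷ʳ r' y)) ⟩
      length s                      ∎
      where open ≡-Reasoning
    starts-late : length xs ≢ 0
    starts-late z = x≢s (at-determined (subst (λ a → At s a (r ∷ʳ y)) z A) (at-whole s)
                                       (subst (λ a → a + length (r ∷ʳ y) ≡ length s) z ends))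

  composable-pieces : ∀ u k v → IsSegment T (u ++ k ∷ v) → 1 ≤ length u → 1 ≤ length v →
                      Composable T (u ∷ʳ k) (k ∷ v)
  composable-pieces u k v sg lu lv =
    u , k , v , refl , refl , segment-block sg left l2 , segment-block sg right (s≤s lv) ,
    (λ z → glue-shares-only u (proj₁ (proj₂ sg))) , sg
    where
    left : At (u ++ k ∷ v) 0 (u ∷ʳ k)
    left = [] , v , sym (++-assoc u [ k ] v) , refl
    right : At (u ++ k ∷ v) (length u) (k ∷ v)
    right = u , [] , cong (u ++_) (sym (++-identityʳ (k ∷ v))) , refl
    l2 : 2 ≤ length (u ∷ʳ k)
    l2 = subst (2 ≤_) (sym (length-∷ʳ u k)) (s≤s lu)

  blocks-composable : ∀ {s a b y z} → IsSegment T s → At s a y → At s b z →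
                      a + length y ≡ suc b → 2 ≤ length y → 2 ≤ length z → Composable T y z
  blocks-composable {s} {a} {b} {y} {k' ∷ v} sg Ay Az end l2y (s≤s lv) with initLast y
  blocks-composable sg Ay Az end () _ | []
  ... | u ∷ʳ′ k =
    subst (λ c → Composable T (u ∷ʳ k) (c ∷ v)) k≡k'
      (composable-pieces u k v (segment-block sg glued two) lu lv)
    where
    b≡ : b ≡ a + length u
    b≡ = suc-injective (sym (trans (sym (+-suc a (length u))) (trans (cong (a +_) (sym (length-∷ʳ u k))) end)))
    meeting : k ≡ k' × At s a (u ++ k ∷ v)
    meeting = at-glue u k k' v Ay (subst (λ c → At s c (k' ∷ v)) b≡ Az)
    k≡k' : k ≡ k'
    k≡k' = proj₁ meeting
    glued : At s a (u ++ k ∷ v)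
    glued = proj₂ meeting
    lu : 1 ≤ length u
    lu = s≤s⁻¹ (subst (2 ≤_) (length-∷ʳ u k) l2y)
    two : 2 ≤ length (u ++ k ∷ v)
    two = subst (2 ≤_) (sym (length-++ u)) (≤-trans (s≤s lv) (m≤n+m (suc (length v)) (length u)))

  junction-offset : ∀ {s a b y z} → Unique s → Composable T y z → At s a y → At s b z →
                    a + length y ≡ suc b
  junction-offset {a = a} un (u , k , v , refl , refl , _) Ay Az =
    trans (cong (a +_) (length-∷ʳ u k))
          (trans (+-suc a (length u)) (cong suc (at-offset₁ un (at-last u k Ay) (at-head Az))))

  BreakAt : Path → ℕ → Path → Path → Set
  BreakAt s i p q = At s 0 p × length p ≡ suc i × At s i q × i + length q ≡ length s ×
                    1 ≤ i × 2 ≤ length q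

  break⇒BreakAt : ∀ {s p q} → IsBreak T s (p , q) → Σ ℕ λ i → BreakAt s i p q
  break⇒BreakAt {s} (xs , b , ys , e , xs≢[] , ys≢[] , refl , refl) =
    length xs ,
    ([] , ys , trans e (sym (++-assoc xs [ b ] ys)) , refl) , length-∷ʳ xs b ,
    (xs , [] , trans e (cong (xs ++_) (sym (++-identityʳ (b ∷ ys)))) , refl) ,
    sym (trans (cong length e) (length-++ xs)) , nonempty xs≢[] , s≤s (nonempty ys≢[])
    where
    nonempty : ∀ {l : Path} → l ≢ [] → 1 ≤ length l
    nonempty {[]}    l≢[] = ⊥-elim (l≢[] refl)
    nonempty {_ ∷ _} _    = s≤s z≤n

  BreakAt⇒break : ∀ {s i p q} → BreakAt s i p q → IsBreak T s (p , q)
  BreakAt⇒break {s} {i} {p} {q} (Ap , lp , Aq , lq , i1 , q2)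
    with w , k , y , e , refl ← split-at s i (subst (i <_) lq (m<m+n i (<⇒≤ q2))) =
    w , k , y , e , w≢[] , y≢[] , p≡ , q≡
    where
    w≢[] : w ≢ []
    w≢[] refl = n>0⇒n≢0 i1 refl
    lq' : length q ≡ suc (length y)
    lq' = +-cancelˡ-≡ (length w) (length q) (suc (length y)) (trans lq (trans (cong length e) (length-++ w)))
    y≢[] : y ≢ []
    y≢[] refl = 1+n≰n (subst (2 ≤_) lq' q2)
    p≡ : p ≡ w ∷ʳ k
    p≡ = at-determined Ap ([] , y , trans e (sym (++-assoc w [ k ] y)) , refl) (trans lp (sym (length-∷ʳ w k)))
    q≡ : q ≡ k ∷ y
    q≡ = at-determined Aq (w , [] , trans e (cong (w ++_) (sym (++-identityʳ (k ∷ y)))) , refl) lq'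

  InRange : Path → ℕ → Set
  InRange s j = 1 ≤ j × j + 2 ≤ length s

  breakAt-range : ∀ {s i p q} → BreakAt s i p q → InRange s i
  breakAt-range {i = i} (_ , _ , _ , lq , i1 , q2) = i1 , ≤-trans (+-monoʳ-≤ i q2) (≤-reflexive lq)

  breakAt : ∀ s j → InRange s j → BreakAt s j (take (suc j) s) (drop j s)
  breakAt s j (j1 , le) =
    proj₁ p , proj₂ p , proj₁ q , proj₂ q , j1 ,
    +-cancelˡ-≤ j 2 _ (≤-trans le (≤-reflexive (sym (proj₂ q))))
    where
    p : At s 0 (take (suc j) s) × length (take (suc j) s) ≡ suc j
    p = at-take s (suc j) (≤-trans (≤-reflexive (+-comm 1 j)) (≤-trans (+-monoʳ-≤ j (s≤s z≤n)) le))
    q : At s j (drop j s) × j + length (drop j s) ≡ length s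
    q = at-drop s j (≤-trans (m≤m+n j 2) le)

  breakAt-unique : ∀ {s i p q p' q'} → BreakAt s i p q → BreakAt s i p' q' → p ≡ p' × q ≡ q'
  breakAt-unique {i = i} (Ap , lp , Aq , lq , _) (Ap' , lp' , Aq' , lq' , _) =
    at-determined Ap Ap' (trans lp (sym lp')) ,
    at-determined Aq Aq' (+-cancelˡ-≡ i _ _ (trans lq (sym lq')))

  break-prefix : ∀ {s i p q} → BreakAt s i p q → IsPrefix s p
  break-prefix {s} {i} (Ap , lp , _ , lq , i1 , q2) =
    Ap , subst (2 ≤_) (sym lp) (s≤s i1) ,
    subst (_< length s) (sym lp) (subst (_≤ length s) (+-comm i 2) (≤-trans (+-monoʳ-≤ i q2) (≤-reflexive lq)))

  break-suffix : ∀ {s i p q} → BreakAt s i p q → IsSuffix s q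
  break-suffix {i = i} (_ , _ , Aq , lq , i1 , q2) = i , Aq , lq , q2 , i1

  InBreak : Path → ℕ → Path → Set
  InBreak s j x = (At s 0 x × length x ≡ suc j) ⊎ (At s j x × j + length x ≡ length s)

  inBreak-parts : ∀ {s j p q x} → BreakAt s j p q → InBreak s j x → x ≡ p ⊎ x ≡ q
  inBreak-parts (Ap , lp , _ , _ , _ , _) (inj₁ (A , l)) = inj₁ (at-determined A Ap (trans l (sym lp)))
  inBreak-parts {j = j} (_ , _ , Aq , lq , _ , _) (inj₂ (A , l)) =
    inj₂ (at-determined A Aq (+-cancelˡ-≡ j _ _ (trans l (sym lq))))

  inBreak-index : ∀ {s j j' x} → Unique s → 1 ≤ j → 1 ≤ j' → 1 ≤ length x →
                  InBreak s j x → InBreak s j' x → j ≡ j'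
  inBreak-index _ _ _ _ (inj₁ (_ , l)) (inj₁ (_ , l')) = suc-injective (trans (sym l) l')
  inBreak-index {j = j} {j'} {x} _ _ _ _ (inj₂ (_ , l)) (inj₂ (_ , l')) =
    +-cancelʳ-≡ (length x) j j' (trans l (sym l'))
  inBreak-index un _ j1' lx (inj₁ (A , _)) (inj₂ (B , _)) = ⊥-elim (n>0⇒n≢0 j1' (sym (at-offset un A B lx)))
  inBreak-index un j1 _ lx (inj₂ (B , _)) (inj₁ (A , _)) = ⊥-elim (n>0⇒n≢0 j1 (sym (at-offset un A B lx)))

  split-inBreak : ∀ {s x} → Unique s → IsSplit T x s → Σ ℕ λ j → InRange s j × InBreak s j x
  split-inBreak {s} {x} un sp with split⇒prefix⊎suffix un sp
  split-inBreak {x = []}    un sp | inj₁ (_ , () , _)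
  split-inBreak {s} {y ∷ r} un sp | inj₁ (A0 , l2 , lt) =
    length r , (s≤s⁻¹ l2 , subst (_≤ length s) (+-comm 2 (length r)) lt) , inj₁ (A0 , refl)
  ... | inj₂ (a , Aa , eq , l2 , a1) = a , (a1 , ≤-trans (+-monoʳ-≤ a l2) (≤-reflexive eq)) , inj₂ (Aa , eq)

  -- Paths have decidable equality; this makes break indices computable and
  -- membership in the list enumerating a label decidable.
  _≟ₚ_ : DecidableEquality Path
  _≟ₚ_ = ≡-dec (_≟ᶠ_ {PlaneTree.n T})

  open DecMembership _≟ₚ_ using (_∈?_)

  -- The position of the break containing a split x of s, computed from x:
  -- a prefix with j + 1 vertices lies in break j, and so does a suffix at offset j.
  breakIndex : Path → Path → ℕ
  breakIndex s x with _≟ₚ_ x (take (length x) s)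
  ... | yes _ = pred (length x)
  ... | no  _ = length s ∸ length x

  breakIndex-correct : ∀ {s x j} → Unique s → 1 ≤ j → 1 ≤ length x → InBreak s j x → breakIndex s x ≡ j
  breakIndex-correct {s} {x} {j} un j1 lx inB with _≟ₚ_ x (take (length x) s)
  breakIndex-correct un j1 lx (inj₁ (_ , l)) | yes _ = cong pred l
  breakIndex-correct {s} {x} {j} un j1 lx (inj₂ (Aj , _)) | yes x≡ =
    ⊥-elim (n>0⇒n≢0 j1 (sym (at-offset un Ax0 Aj lx)))
    where
    Ax0 : At s 0 x
    Ax0 = subst (At s 0) (sym x≡) (proj₁ (at-take s (length x) (≤-trans (m≤n+m _ j) (at-bound Aj))))
  breakIndex-correct {s} {x} un j1 lx (inj₁ (A0 , _)) | no x≢ =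
    ⊥-elim (x≢ (at-determined A0 (proj₁ prefix) (sym (proj₂ prefix))))
    where
    prefix : At s 0 (take (length x) s) × length (take (length x) s) ≡ length x
    prefix = at-take s (length x) (at-bound A0)
  breakIndex-correct {s} {x} {j} un j1 lx (inj₂ (_ , l)) | no _ =
    trans (cong (_∸ length x) (sym l)) (m+n∸n≡m j (length x))

  split-breakIndex : ∀ {s x} → Unique s → IsSplit T x s →
                     InRange s (breakIndex s x) × InBreak s (breakIndex s x) x
  split-breakIndex {s} {x} un sp with j , r , inB ← split-inBreak un sp =
    subst (λ j → InRange s j × InBreak s j x) (sym (breakIndex-correct un (proj₁ r) lx inB)) (r , inB)
    where
    lx : 1 ≤ length x
    lx = <⇒≤ (proj₁ (proj₁ (proj₁ sp)))

  Covering : Path → (Path → Set) → Set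
  Covering s P = ∀ p q → IsBreak T s (p , q) → P p ⊎ P q

  Exclusive : Path → (Path → Set) → Set
  Exclusive s P = ∀ p q → IsBreak T s (p , q) → P p → P q → ⊥

  exclusive⇒noSameBreak : ∀ {s P} → Exclusive s P → ∀ d₁ d₂ → P d₁ → P d₂ → ¬ SameBreak T s d₁ d₂
  exclusive⇒noSameBreak ex d₁ d₂ P₁ P₂ (d₁≢d₂ , p , q , b , inj₁ refl , inj₁ refl) = d₁≢d₂ refl
  exclusive⇒noSameBreak ex d₁ d₂ P₁ P₂ (d₁≢d₂ , p , q , b , inj₂ refl , inj₂ refl) = d₁≢d₂ refl
  exclusive⇒noSameBreak ex d₁ d₂ P₁ P₂ (d₁≢d₂ , p , q , b , inj₁ refl , inj₂ refl) = ex p q b P₁ P₂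
  exclusive⇒noSameBreak ex d₁ d₂ P₁ P₂ (d₁≢d₂ , p , q , b , inj₂ refl , inj₁ refl) = ex p q b P₂ P₁

  -- The two parts of a break are different (they start at different offsets).
  noSameBreak⇒exclusive : ∀ {s P} → Unique s → (∀ d₁ d₂ → P d₁ → P d₂ → ¬ SameBreak T s d₁ d₂) →
                          Exclusive s P
  noSameBreak⇒exclusive {s} un noSame p q b Pp Pq with i , (Ap , lp , Aq , _ , i1 , _) ← break⇒BreakAt b =
    noSame p q Pp Pq (p≢q , p , q , b , inj₁ refl , inj₂ refl)
    where
    p≢q : p ≢ q
    p≢q refl = n>0⇒n≢0 i1 (sym (at-offset un Ap Aq (subst (1 ≤_) (sym lp) (s≤s z≤n))))

  exclusive-unique : ∀ {s P j p q x y} → Exclusive s P → BreakAt s j p q →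
                     P x → InBreak s j x → P y → InBreak s j y → x ≡ y
  exclusive-unique ex b Px inx Py iny with inBreak-parts b inx | inBreak-parts b iny
  ... | inj₁ refl | inj₁ refl = refl
  ... | inj₂ refl | inj₂ refl = refl
  ... | inj₁ refl | inj₂ refl = ⊥-elim (ex _ _ (BreakAt⇒break b) Px Py)
  ... | inj₂ refl | inj₁ refl = ⊥-elim (ex _ _ (BreakAt⇒break b) Py Px)

  Position : Path → Set
  Position s = Σ ℕ (InRange s)

  interior : ∀ s k → k + 2 ≤ length s → List (Position s)
  interior s zero    _  = []
  interior s (suc k) le = (suc k , s≤s z≤n , le) ∷ interior s k (≤-trans (n≤1+n _) le)

  interior-length : ∀ s k le → length (interior s k le) ≡ k
  interior-length s zero    _ = refl
  interior-length s (suc k) _ = cong suc (interior-length s k _)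

  interior-complete : ∀ s k le j → 1 ≤ j → j ≤ k → Σ (Position s) λ e → e ∈ interior s k le × proj₁ e ≡ j
  interior-complete s zero    le j j1 z≤n = ⊥-elim (n>0⇒n≢0 j1 refl)
  interior-complete s (suc k) le j j1 jk with j ≟ suc k
  ... | yes refl = _ , here refl , refl
  ... | no j≢ with e , e∈ , eq ← interior-complete s k _ j j1 (s≤s⁻¹ (≤∧≢⇒< jk j≢)) = e , there e∈ , eq

  interior-unique : ∀ {B : Set} s (f : Position s → B) → (∀ e e' → f e ≡ f e' → proj₁ e ≡ proj₁ e') →
                    ∀ k le → Unique (map f (interior s k le))
  interior-unique s f inj zero    _  = []
  interior-unique s f inj (suc k) le =
    All.map⁺ (All.map (λ {e} e≤k eq → 1+n≰n (subst (_≤ k) (sym (inj _ e eq)) e≤k)) (below k _)) ∷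
    interior-unique s f inj k _
    where
    below : ∀ k le → All (λ e → proj₁ e ≤ k) (interior s k le)
    below zero    _ = []
    below (suc k) _ = ≤-refl ∷ All.map m≤n⇒m≤1+n (below k _)

  card-by-positions : ∀ {B : Set} s → 2 ≤ length s → (P : B → Set) (f : Position s → B) →
                      (∀ e → P (f e)) → (∀ e e' → f e ≡ f e' → proj₁ e ≡ proj₁ e') →
                      (∀ x → P x → Σ ℕ λ j → InRange s j × (∀ r → f (j , r) ≡ x)) →
                      HasCard P (length s ∸ 2)
  card-by-positions s l2 P f f-P f-inj f-onto =
    map f (interior s N top) , interior-unique s f f-inj N top , (λ x → mk⇔ (to x) (from x)) ,
    trans (length-map f (interior s N top)) (interior-length s N top)
    where
    N : ℕ
    N = length s ∸ 2
    top : N + 2 ≤ length s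
    top = ≤-reflexive (m∸n+n≡m l2)
    to : ∀ x → P x → x ∈ map f (interior s N top)
    to x Px with j , (j1 , le) , hit ← f-onto x Px
      with (_ , r) , e∈ , refl ← interior-complete s N top j j1 (m+n≤o⇒m≤o∸n j le) =
      subst (_∈ map f (interior s N top)) (hit r) (∈-map⁺ f e∈)
    from : ∀ x → x ∈ map f (interior s N top) → P x
    from x x∈ with e , _ , refl ← ∈-map⁻ f x∈ = f-P e

  breaks-card : ∀ s → 2 ≤ length s → HasCard (IsBreak T s) (length s ∸ 2)
  breaks-card s l2 = card-by-positions s l2 (IsBreak T s) cut is-break inj onto
    where
    cut : Position s → Path × Path
    cut (j , _) = take (suc j) s , drop j s
    is-break : ∀ e → IsBreak T s (cut e)
    is-break (j , r) = BreakAt⇒break (breakAt s j r)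
    inj : ∀ e e' → cut e ≡ cut e' → proj₁ e ≡ proj₁ e'
    inj (j , r) (j' , r') eq = suc-injective (begin
      suc j                          ≡⟨ sym (proj₁ (proj₂ (breakAt s j r))) ⟩
      length (take (suc j) s)        ≡⟨ cong (λ c → length (proj₁ c)) eq ⟩
      length (take (suc j') s)       ≡⟨ proj₁ (proj₂ (breakAt s j' r')) ⟩
      suc j'                         ∎)
      where open ≡-Reasoning
    onto : ∀ pq → IsBreak T s pq → Σ ℕ λ j → InRange s j × (∀ r → cut (j , r) ≡ pq)
    onto (p , q) b with i , bi ← break⇒BreakAt b =
      i , breakAt-range bi , λ r → let (p≡ , q≡) = breakAt-unique (breakAt s i r) bi in cong₂ _,_ p≡ q≡

  one-per-break-card : ∀ {s} (P : Path → Set) → IsSegment T s → (∀ x → P x → IsSplit T x s) →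
                       Covering s P → Exclusive s P → HasCard P (length s ∸ 2)
  one-per-break-card {s} P sg splits cover ex =
    card-by-positions s (proj₁ sg) P (proj₁ ∘ chosen) (λ e → proj₁ (proj₂ (chosen e))) inj onto
    where
    un : Unique s
    un = proj₁ (proj₂ sg)
    chosen : (e : Position s) → Σ Path λ x → P x × InBreak s (proj₁ e) x
    chosen (j , r) = choose (breakAt s j r)
      where
      choose : ∀ {p q} → BreakAt s j p q → Σ Path λ x → P x × InBreak s j x
      choose b@(Ap , lp , Aq , lq , _) with cover _ _ (BreakAt⇒break b)
      ... | inj₁ Pp = _ , Pp , inj₁ (Ap , lp)
      ... | inj₂ Pq = _ , Pq , inj₂ (Aq , lq)
    inj : ∀ e e' → proj₁ (chosen e) ≡ proj₁ (chosen e') → proj₁ e ≡ proj₁ e'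
    inj e@(j , r) e'@(j' , r') eq with chosen e | chosen e'
    ... | x , Px , inB | _ , _ , inB' with refl ← eq =
      inBreak-index un (proj₁ r) (proj₁ r') (<⇒≤ (proj₁ (proj₁ (proj₁ (splits x Px))))) inB inB'
    onto : ∀ x → P x → Σ ℕ λ j → InRange s j × (∀ r → proj₁ (chosen (j , r)) ≡ x)
    onto x Px with j , r , inB ← split-inBreak un (splits x Px) =
      j , r , λ r' → let (y , Py , inB') = chosen (j , r') in
                     exclusive-unique ex (breakAt s j r') Py inB' Px inB

  -- A label meets every break: its splits lie in pairwise different breaks and
  -- there are as many of them as breaks, so a break avoided by D would leave
  -- length s ∸ 2 + 1 distinct positions among the length s ∸ 2 interior ones.
  label-covers : ∀ {s D} → IsLabel T s D → Covering s D
  label-covers {s} {D} (sg , splits , noSame , m , Hb , L , uL , D⇔L , lL) p q b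
    with i , bi ← break⇒BreakAt b | p ∈? L | q ∈? L
  ... | yes p∈L | _       = inj₁ (Equivalence.from (D⇔L p) p∈L)
  ... | no _    | yes q∈L = inj₂ (Equivalence.from (D⇔L q) q∈L)
  ... | no p∉L  | no q∉L  = ⊥-elim (1+n≰n too-many)
    where
    N : ℕ
    N = length s ∸ 2
    un : Unique s
    un = proj₁ (proj₂ sg)
    index : Path → ℕ
    index = breakIndex s
    located : ∀ {d} → d ∈ L → InRange s (index d) × InBreak s (index d) d
    located {d} d∈ = split-breakIndex un (splits d (Equivalence.from (D⇔L d) d∈))
    outside : ∀ {d} → d ∈ L → i ≢ index d
    outside {d} d∈ i≡ =
      ⊎-elim (λ d≡p → p∉L (subst (_∈ L) d≡p d∈)) (λ d≡q → q∉L (subst (_∈ L) d≡q d∈))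
      (inBreak-parts bi (subst (λ z → InBreak s z d) (sym i≡) (proj₂ (located d∈))))
    index-injective : ∀ {x y} → x ∈ L → y ∈ L → index x ≡ index y → x ≡ y
    index-injective {x} {y} x∈ y∈ eq = decidable-stable (_≟ₚ_ x y) λ x≢y →
                     noSame x y (Equivalence.from (D⇔L x) x∈) (Equivalence.from (D⇔L y) y∈)
                     (x≢y , _ , _ , BreakAt⇒break bx , inBreak-parts bx (proj₂ (located x∈)) ,
                      inBreak-parts bx (subst (λ z → InBreak s z y) (sym eq) (proj₂ (located y∈))))
      where
      bx : BreakAt s (index x) (take (suc (index x)) s) (drop (index x) s)
      bx = breakAt s (index x) (proj₁ (located x∈))
    range⇒∈ : ∀ {j} → InRange s j → j ∈ applyUpTo suc N
    range⇒∈ {suc j} (_ , le) = ∈-applyUpTo⁺ suc (m+n≤o⇒m≤o∸n (suc j) le)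
    -- the break avoided by D, followed by the breaks of the members of D
    Z : List ℕ
    Z = i ∷ map index L
    uniqueZ : Unique Z
    uniqueZ = All.map⁺ (All.tabulate outside) ∷ unique-map index uL index-injective
    Z⊆ : ∀ {z} → z ∈ Z → z ∈ applyUpTo suc N
    Z⊆ (here refl) = range⇒∈ (breakAt-range bi)
    Z⊆ (there z∈) = let (d , d∈ , z≡) = ∈-map⁻ index z∈ in
      subst (_∈ applyUpTo suc N) (sym z≡) (range⇒∈ (proj₁ (located d∈)))
    too-many : suc N ≤ N
    too-many = begin
      suc N                      ≡⟨ cong suc (hasCard-unique (breaks-card s (proj₁ sg)) Hb) ⟩
      suc m                      ≡⟨ cong suc (sym lL) ⟩
      suc (length L)             ≡⟨ cong suc (sym (length-map index L)) ⟩
      length Z                   ≤⟨ unique-⊆⇒length≤ uniqueZ Z⊆ ⟩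
      length (applyUpTo suc N)   ≡⟨ length-applyUpTo suc N ⟩
      N                          ∎
      where open ≤-Reasoning

-- The interval description of J(s_D).  Throughout, D contains splits of the
-- segment s and exactly one part of every break of s (as every label does).
module Intervals (T : PlaneTree) (s : List (V T)) (D : List (V T) → Set)
                 (sg : IsSegment T s) (splits : ∀ d → D d → IsSplit T d s)
                 (cover : Covering T s D) (excl : Exclusive T s D) where

  private
    Path : Set
    Path = List (V T)

    un : Unique s
    un = proj₁ (proj₂ sg)

    s∉D : ¬ D s
    s∉D Ds = proj₁ (proj₂ (splits s Ds)) refl

  LeftCut : ℕ → Set
  LeftCut a = a ≡ 0 ⊎ Σ Path λ q → At s a q × a + length q ≡ length s × D q

  RightCut : ℕ → Set
  RightCut e = e ≡ length s ⊎ Σ Path λ p → At s 0 p × length p ≡ e × D p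

  -- The blocks of s with admissible ends; they will turn out to be J(s_D).
  Interval : Path → Set
  Interval x = Σ ℕ λ a → At s a x × 2 ≤ length x × LeftCut a × RightCut (a + length x)

  NotComposable : Path → Set
  NotComposable x = ∀ u → D u → ¬ ComposableWith T x u

  cuts-cover : ∀ {j p q} → BreakAt T s j p q → RightCut (suc j) ⊎ LeftCut j
  cuts-cover b@(Ap , lp , Aq , lq , _) with cover _ _ (BreakAt⇒break T b)
  ... | inj₁ Dp = inj₁ (inj₂ (_ , Ap , lp , Dp))
  ... | inj₂ Dq = inj₂ (inj₂ (_ , Aq , lq , Dq))

  cuts-exclusive : ∀ {j} → InRange T s j → RightCut (suc j) → LeftCut j → ⊥
  cuts-exclusive {j} (j1 , le) (inj₁ e) _ = no-room-after j 2 (subst (j + 2 ≤_) (sym e) le) ≤-refl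
  cuts-exclusive (j1 , le) (inj₂ _) (inj₁ j≡0) = n>0⇒n≢0 j1 j≡0
  cuts-exclusive {j} (j1 , le) (inj₂ (p , Ap , lp , Dp)) (inj₂ (q , Aq , lq , Dq)) =
    excl p q (BreakAt⇒break T (Ap , lp , Aq , lq , j1 , q2)) Dp Dq
    where
    q2 : 2 ≤ length q
    q2 = +-cancelˡ-≤ j 2 (length q) (≤-trans le (≤-reflexive (sym lq)))

  leftCut-of-noncomposable : ∀ {a x} → At s a x → 2 ≤ length x → 1 ≤ a → NotComposable x → LeftCut a
  leftCut-of-noncomposable {a} {x} A l2 a1 nc =
    at-break (breakAt T s a (a1 , ≤-trans (+-monoʳ-≤ a l2) (at-bound A)))
    where
    at-break : ∀ {p q} → BreakAt T s a p q → LeftCut a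
    at-break b@(Ap , lp , Aq , lq , _) with cover _ _ (BreakAt⇒break T b)
    ... | inj₁ Dp =
      ⊥-elim (nc _ Dp (inj₂ (blocks-composable T sg Ap A lp (subst (2 ≤_) (sym lp) (s≤s a1)) l2)))
    ... | inj₂ Dq = inj₂ (_ , Aq , lq , Dq)

  rightCut-of-noncomposable : ∀ {c x} → At s c x → 2 ≤ length x → c + length x < length s →
                              NotComposable x → RightCut (c + length x)
  rightCut-of-noncomposable {c} {x} A l2 lt nc with c + length x in end
  ... | zero  = ⊥-elim (n>0⇒n≢0 (<⇒≤ (≤-trans l2 (m≤n+m (length x) c))) end)
  ... | suc j = at-break (breakAt T s j (s≤s⁻¹ two , subst (_≤ length s) (+-comm 2 j) lt))
    where
    two : 2 ≤ suc j
    two = subst (2 ≤_) end (≤-trans l2 (m≤n+m (length x) c))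
    at-break : ∀ {p q} → BreakAt T s j p q → RightCut (suc j)
    at-break b@(Ap , lp , Aq , lq , _ , q2) with cover _ _ (BreakAt⇒break T b)
    ... | inj₁ Dp = inj₂ (_ , Ap , lp , Dp)
    ... | inj₂ Dq = ⊥-elim (nc _ Dq (inj₁ (blocks-composable T sg A Aq end l2 q2)))

  -- A split x of a prefix d ∈ D that is not a split of s is a suffix of d; its
  -- right end is cut by d and its left end by non-composability.
  inside-prefix : ∀ {x d} → D d → IsPrefix T s d → IsSplit T x d → ¬ IsSplit T x s →
                  NotComposable x → Interval x
  inside-prefix {x} {d} Dd (Ad , _ , ltd) x-split ¬split nc
    with split⇒prefix⊎suffix T (at-unique un Ad) x-split
  ... | inj₁ (Ax , l2 , ltx) = ⊥-elim (¬split (prefix⇒split T sg (at-trans Ad Ax , l2 , <-trans ltx ltd)))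
  ... | inj₂ (a , Ax , eq , l2 , a1) =
    a , at-trans Ad Ax , l2 , leftCut-of-noncomposable (at-trans Ad Ax) l2 a1 nc , inj₂ (d , Ad , sym eq , Dd)

  -- Symmetrically, such a split of a suffix d ∈ D is a prefix of d.
  inside-suffix : ∀ {x d} → D d → IsSuffix T s d → IsSplit T x d → ¬ IsSplit T x s →
                  NotComposable x → Interval x
  inside-suffix {x} {d} Dd (c , Ad , eqd , _ , c1) x-split ¬split nc
    with split⇒prefix⊎suffix T (at-unique un Ad) x-split
  ... | inj₂ (a , Ax , eqx , l2 , _) =
    ⊥-elim (¬split (suffix⇒split T sg (c + a , at-trans Ad Ax , ends , l2 , ≤-trans c1 (m≤m+n c a))))
    where
    ends : c + a + length x ≡ length s
    ends = trans (+-assoc c a (length x)) (trans (cong (c +_) eqx) eqd)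
  ... | inj₁ (Ax , l2 , ltx) =
    c , Asx , l2 , inj₂ (d , Ad , eqd , Dd) , rightCut-of-noncomposable Asx l2 lt nc
    where
    Asx : At s c x
    Asx = subst (λ z → At s z x) (+-identityʳ c) (at-trans Ad Ax)
    lt : c + length x < length s
    lt = subst (c + length x <_) eqd (+-monoʳ-< c ltx)

  -- Every member of J(s_D) is an interval: s itself, a member of D (cut by
  -- itself and an end of s), or a member of S(d) by the two lemmas above.
  J⇒interval : ∀ {x} → InJ T s D x → Interval x
  J⇒interval (inj₁ refl) = 0 , at-whole s , proj₁ sg , inj₁ refl , inj₁ refl
  J⇒interval {x} (inj₂ (inj₁ Dx)) with split⇒prefix⊎suffix T un (splits x Dx)
  ... | inj₁ (A0 , l2 , _)        = 0 , A0 , l2 , inj₁ refl , inj₂ (x , A0 , refl , Dx)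
  ... | inj₂ (a , Aa , eq , l2 , _) = a , Aa , l2 , inj₂ (x , Aa , eq , Dx) , inj₁ eq
  J⇒interval (inj₂ (inj₂ (d , Dd , x-split , ¬split , nc))) with split⇒prefix⊎suffix T un (splits d Dd)
  ... | inj₁ d-prefix = inside-prefix Dd d-prefix x-split ¬split nc
  ... | inj₂ d-suffix = inside-suffix Dd d-suffix x-split ¬split nc

  middle-in-S : ∀ {a x p q} → At s a x → 2 ≤ length x → 1 ≤ a → a + length x < length s →
                At s a q → a + length q ≡ length s → D q →
                At s 0 p → length p ≡ a + length x → D p → InS T s D p x
  middle-in-S {a} {x} {p} {q} Ax l2 a1 lt Aq eq Dq Ap lp Dp = x-split , ¬split , nc
    where
    lx : 1 ≤ length x
    lx = <⇒≤ l2
    x-split : IsSplit T x p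
    x-split = suffix⇒split T (segment-block T sg Ap p2) (a , at-restrict Ap Ax lp , sym lp , l2 , a1)
      where
      p2 : 2 ≤ length p
      p2 = subst (2 ≤_) (sym lp) (≤-trans l2 (m≤n+m (length x) a))
    ¬split : ¬ IsSplit T x s
    ¬split sp with split⇒prefix⊎suffix T un sp
    ... | inj₁ (A0 , _)          = n>0⇒n≢0 a1 (at-offset un Ax A0 lx)
    ... | inj₂ (a' , Aa' , eq' , _) =
      <-irrefl (subst (λ z → z + length x ≡ length s) (at-offset un Aa' Ax lx) eq') lt
    q2 : 2 ≤ length q
    q2 = ≤-trans l2 (<⇒≤ (+-cancelˡ-< a (length x) (length q) (subst (a + length x <_) (sym eq) lt)))
    -- A member u of D following x would start at the last vertex of x: it is
    -- not a prefix of s, and as a suffix it would share a break with p.  One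
    -- preceding x would end at the first vertex of x: as a prefix it would
    -- share a break with q, and as a suffix it would leave no room for x.
    nc : NotComposable x
    nc u Du c with split-inBreak T un (splits u Du)
    nc u Du (inj₁ x∘u) | j , _ , inj₁ (Au , _) =
      1+n≰n (subst (2 ≤_) (junction-offset T un x∘u Ax Au) (≤-trans l2 (m≤n+m (length x) a)))
    nc u Du (inj₁ x∘u) | j , (j1 , le) , inj₂ (Au , lu) =
      excl p u (BreakAt⇒break T (Ap , trans lp (junction-offset T un x∘u Ax Au) , Au , lu , j1 ,
                                 +-cancelˡ-≤ j 2 (length u) (≤-trans le (≤-reflexive (sym lu))))) Dp Du
    nc u Du (inj₂ u∘x) | j , _ , inj₁ (Au , _) =
      excl u q (BreakAt⇒break T (Au , junction-offset T un u∘x Au Ax , Aq , eq , a1 , q2)) Du Dq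
    nc u Du (inj₂ u∘x) | j , _ , inj₂ (Au , lu) =
      no-room-after a (length x) (<⇒≤ (subst (a + length x <_) s-ends lt)) l2
      where
      s-ends : length s ≡ suc a
      s-ends = trans (sym lu) (junction-offset T un u∘x Au Ax)

  -- Conversely, depending on its cuts an interval is s, a member of D, or a
  -- block cut by D on both sides, hence in S(p) for the prefix p cutting it.
  interval⇒J : ∀ {x} → Interval x → InJ T s D x
  interval⇒J (a , Ax , l2 , inj₁ refl , inj₁ e) = inj₁ (at-determined Ax (at-whole s) e)
  interval⇒J (a , Ax , l2 , inj₁ refl , inj₂ (p , Ap , lp , Dp)) =
    inj₂ (inj₁ (subst D (at-determined Ap Ax lp) Dp))
  interval⇒J (a , Ax , l2 , inj₂ (q , Aq , eq , Dq) , inj₁ e) =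
    inj₂ (inj₁ (subst D (at-determined Aq Ax (+-cancelˡ-≡ a _ _ (trans eq (sym e)))) Dq))
  interval⇒J (zero , Ax , l2 , inj₂ (q , Aq , eq , Dq) , inj₂ _) =
    ⊥-elim (s∉D (subst D (at-determined Aq (at-whole s) eq) Dq))
  interval⇒J {x} (suc a , Ax , l2 , inj₂ (q , Aq , eq , Dq) , inj₂ (p , Ap , lp , Dp))
    with suc a + length x ≟ length s
  ... | yes e = ⊥-elim (s∉D (subst D (at-determined Ap (at-whole s) (trans lp e)) Dp))
  ... | no ne =
    inj₂ (inj₂ (p , Dp , middle-in-S Ax l2 (s≤s z≤n) (≤∧≢⇒< (at-bound Ax) ne) Aq eq Dq Ap lp Dp))

  J⇔cuts : ∀ {a x} → At s a x → 2 ≤ length x → InJ T s D x ⇔ (LeftCut a × RightCut (a + length x))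
  J⇔cuts {a} {x} Ax l2 = mk⇔ to (λ (lc , rc) → interval⇒J (a , Ax , l2 , lc , rc))
    where
    to : InJ T s D x → LeftCut a × RightCut (a + length x)
    to j with a' , Ax' , _ , lc , rc ← J⇒interval j with refl ← at-offset un Ax' Ax (<⇒≤ l2) = lc , rc

-- The setting of the theorem: a label s_D and a member t of J(s_D); P is D(t).
module Heredity (T : PlaneTree) (s : List (V T)) (D : List (V T) → Set) (lab : IsLabel T s D)
                (t : List (V T)) (tJ : InJ T s D t) where

  private
    sg : IsSegment T s
    sg = proj₁ lab

    un : Unique s
    un = proj₁ (proj₂ sg)

  open Intervals T s D sg (proj₁ (proj₂ lab)) (label-covers T lab)
                 (noSameBreak⇒exclusive T un (proj₁ (proj₂ (proj₂ lab))))

  P : List (V T) → Set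
  P = Dof T s D t

  P-splits : ∀ x → P x → IsSplit T x t
  P-splits _ = proj₂

  P-long : ∀ {x} → P x → 2 ≤ length x
  P-long Px = proj₁ (proj₁ (proj₁ (proj₂ Px)))

  private
    t-interval : Interval t
    t-interval = J⇒interval tJ

    a₀ : ℕ
    a₀ = proj₁ t-interval

    At₀ : At s a₀ t
    At₀ = proj₁ (proj₂ t-interval)

    l2t : 2 ≤ length t
    l2t = proj₁ (proj₂ (proj₂ t-interval))

    lc₀ : LeftCut (a₀ + 0)
    lc₀ = subst LeftCut (sym (+-identityʳ a₀)) (proj₁ (proj₂ (proj₂ (proj₂ t-interval))))

    rc₀ : RightCut (a₀ + length t)
    rc₀ = proj₂ (proj₂ (proj₂ (proj₂ t-interval)))

  sgt : IsSegment T t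
  sgt = segment-block T sg At₀ l2t

  J-in-t : ∀ {b x} → At t b x → 2 ≤ length x →
           InJ T s D x ⇔ (LeftCut (a₀ + b) × RightCut (a₀ + (b + length x)))
  J-in-t {b} {x} Ax l2 = subst (λ e → InJ T s D x ⇔ (LeftCut (a₀ + b) × RightCut e))
                               (+-assoc a₀ b (length x)) (J⇔cuts (at-trans At₀ Ax) l2)

  prefix∈P⇔ : ∀ {p} → IsPrefix T t p → P p ⇔ RightCut (a₀ + length p)
  prefix∈P⇔ pre@(Ap , l2 , _) =
    mk⇔ (λ Pp → proj₂ (Equivalence.to (J-in-t Ap l2) (proj₁ Pp)))
        (λ rc → Equivalence.from (J-in-t Ap l2) (lc₀ , rc) , prefix⇒split T sgt pre)

  suffix∈P⇔ : ∀ {q} → (suf : IsSuffix T t q) → P q ⇔ LeftCut (a₀ + proj₁ suf)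
  suffix∈P⇔ {q} suf@(b , Aq , ends , l2 , _) =
    mk⇔ (λ Pq → proj₁ (Equivalence.to (J-in-t Aq l2) (proj₁ Pq)))
        (λ lc → Equivalence.from (J-in-t Aq l2) (lc , subst (λ e → RightCut (a₀ + e)) (sym ends) rc₀) ,
                suffix⇒split T sgt suf)

  range-in-s : ∀ {i} → InRange T t i → InRange T s (a₀ + i)
  range-in-s {i} (i1 , le) = ≤-trans i1 (m≤n+m i a₀) , (begin
    a₀ + i + 2      ≡⟨ +-assoc a₀ i 2 ⟩
    a₀ + (i + 2)    ≤⟨ +-monoʳ-≤ a₀ le ⟩
    a₀ + length t   ≤⟨ at-bound At₀ ⟩
    length s        ∎)
    where open ≤-Reasoning

  prefix-end : ∀ {i p q} → BreakAt T t i p q → a₀ + length p ≡ suc (a₀ + i)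
  prefix-end {i} (_ , lp , _) = trans (cong (a₀ +_) lp) (+-suc a₀ i)

  -- So P contains exactly one part of each break of t, because s is cut on
  -- exactly one side of the corresponding position.
  cover-t : Covering T t P
  cover-t p q b with i , bi ← break⇒BreakAt T b
    with cuts-cover (breakAt T s (a₀ + i) (range-in-s (breakAt-range T bi)))
  ... | inj₁ rc =
    inj₁ (Equivalence.from (prefix∈P⇔ (break-prefix T bi)) (subst RightCut (sym (prefix-end bi)) rc))
  ... | inj₂ lc = inj₂ (Equivalence.from (suffix∈P⇔ (break-suffix T bi)) lc)

  excl-t : Exclusive T t P
  excl-t p q b Pp Pq with i , bi ← break⇒BreakAt T b =
    cuts-exclusive (range-in-s (breakAt-range T bi))
      (subst RightCut (prefix-end bi) (Equivalence.to (prefix∈P⇔ (break-prefix T bi)) Pp))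
      (Equivalence.to (suffix∈P⇔ (break-suffix T bi)) Pq)

  t-label : IsLabel T t P
  t-label = sgt , P-splits , exclusive⇒noSameBreak T excl-t ,
            length t ∸ 2 , breaks-card T t l2t , one-per-break-card T P sgt P-splits cover-t excl-t

  module Jt = Intervals T t P sgt P-splits cover-t excl-t

  leftCut-transfer : ∀ {b x} → At t b x → 2 ≤ length x → Jt.LeftCut b ⇔ LeftCut (a₀ + b)
  leftCut-transfer {zero} _ _ = mk⇔ (λ _ → lc₀) (λ _ → inj₁ refl)
  leftCut-transfer {suc b} {x} Ax l2 = mk⇔ to from
    where
    to : Jt.LeftCut (suc b) → LeftCut (a₀ + suc b)
    to (inj₂ (q , Aq , ends , Pq)) = proj₁ (Equivalence.to (J-in-t Aq (P-long Pq)) (proj₁ Pq))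
    suffix : At t (suc b) (drop (suc b) t) × suc b + length (drop (suc b) t) ≡ length t
    suffix = at-drop t (suc b) (≤-trans (m≤m+n (suc b) (length x)) (at-bound Ax))
    q2 : 2 ≤ length (drop (suc b) t)
    q2 = ≤-trans l2 (+-cancelˡ-≤ (suc b) _ _ (≤-trans (at-bound Ax) (≤-reflexive (sym (proj₂ suffix)))))
    from : LeftCut (a₀ + suc b) → Jt.LeftCut (suc b)
    from lc = inj₂ (_ , proj₁ suffix , proj₂ suffix ,
                    Equivalence.from (suffix∈P⇔ (suc b , proj₁ suffix , proj₂ suffix , q2 , s≤s z≤n)) lc)

  rightCut-transfer : ∀ {b x} → At t b x → 2 ≤ length x →
                      Jt.RightCut (b + length x) ⇔ RightCut (a₀ + (b + length x))
  rightCut-transfer {b} {x} Ax l2 = mk⇔ to from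
    where
    to : Jt.RightCut (b + length x) → RightCut (a₀ + (b + length x))
    to (inj₁ e) = subst (λ z → RightCut (a₀ + z)) (sym e) rc₀
    to (inj₂ (p , Ap , lp , Pp)) =
      subst (λ z → RightCut (a₀ + z)) lp (proj₂ (Equivalence.to (J-in-t Ap (P-long Pp)) (proj₁ Pp)))
    prefix : At t 0 (take (b + length x) t) × length (take (b + length x) t) ≡ b + length x
    prefix = at-take t (b + length x) (at-bound Ax)
    from : RightCut (a₀ + (b + length x)) → Jt.RightCut (b + length x)
    from rc with b + length x ≟ length t
    ... | yes e = inj₁ e
    ... | no ne = inj₂ (_ , proj₁ prefix , proj₂ prefix ,
                        Equivalence.from (prefix∈P⇔ (proj₁ prefix , l2p , ltp))
                          (subst (λ z → RightCut (a₀ + z)) (sym (proj₂ prefix)) rc))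
      where
      l2p : 2 ≤ length (take (b + length x) t)
      l2p = subst (2 ≤_) (sym (proj₂ prefix)) (≤-trans l2 (m≤n+m (length x) b))
      ltp : length (take (b + length x) t) < length t
      ltp = subst (_< length t) (sym (proj₂ prefix)) (≤∧≢⇒< (at-bound Ax) ne)

  J-blocks-agree : ∀ {b x} → At t b x → 2 ≤ length x → InJ T t P x ⇔ InJ T s D x
  J-blocks-agree Ax l2 =
    ⇔-sym (J-in-t Ax l2) ⇔-∘ ((leftCut-transfer Ax l2 ×-⇔ rightCut-transfer Ax l2) ⇔-∘ Jt.J⇔cuts Ax l2)

  J-of-t : ∀ x → InJ T t P x ⇔ (IsSubseg T x t × InJ T s D x)
  J-of-t x = mk⇔ to from
    where
    to : InJ T t P x → IsSubseg T x t × InJ T s D x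
    to j with b , Ax@(xs , ys , e , _) , l2 , _ ← Jt.J⇒interval j =
      (segment-block T sgt Ax l2 , xs , ys , e) , Equivalence.to (J-blocks-agree Ax l2) j
    from : IsSubseg T x t × InJ T s D x → InJ T t P x
    from ((sgx , xs , ys , e) , Jx) = Equivalence.from (J-blocks-agree (xs , ys , e , refl) (proj₁ sgx)) Jx

  J-of-t⊆J-of-s : ∀ x → InJ T t P x → InJ T s D x
  J-of-t⊆J-of-s x j = proj₂ (Equivalence.to (J-of-t x) j)

lemma4p3 : (T : PlaneTree) (s : List (V T)) (𝒟 : List (V T) → Set) →
    IsLabel T s 𝒟 → (t : List (V T)) → InJ T s 𝒟 t →
    IsLabel T t (Dof T s 𝒟 t)
    × (∀ x → InJ T t (Dof T s 𝒟 t) x → InJ T s 𝒟 x)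
    × (∀ x → InJ T t (Dof T s 𝒟 t) x ⇔ (IsSubseg T x t × InJ T s 𝒟 x))
lemma4p3 T s 𝒟 lab t tJ = t-label , J-of-t⊆J-of-s , J-of-t
  where open Heredity T s 𝒟 lab t tJ
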